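{- Let $G$ be a tree-path intersection graph with the rooting and order $\le$ described in the context. If $s_1,s_2\in\Gamma(s_0)$ and $\min\Gamma(s_0)=v_{\mathrm{root}}$, then $s_1$ and $s_2$ are comparable.
   Context: A tree-path intersection graph is a connected bipartite graph $G$ with disjoint parts $G_H$, $G_V$, together with a tree $T_H$ on vertex set $G_H$ and a tree $T_V$ on vertex set $G_V$, such that for every $h\in G_H$ the neighbourhood $\Gamma(h)$ of $h$ in $G$ is the vertex set of a path in $T_V$, and for every $v\in G_V$ the neighbourhood $\Gamma(v)$ is the vertex set of a path in $T_H$. Fix an edge $h_{\mathrm{root}}v_{\mathrm{root}}\in E(G)$ such that $v_{\mathrm{root}}$ is a leaf of $T_V$; root $T_H$ at $h_{\mathrm{root}}$ and $T_V$ at $v_{\mathrm{root}}$. For $s_1,s_2$ both in $G_H$ (resp. both in $G_V$), $s_1\le s_2$ iff $s_1$ lies on the path of $T_H$ (resp. $T_V$) from the root to $s_2$; vertices from different sides are incomparable; $s_1,s_2$ are comparable if $s_1\le s_2$ or $s_2\le s_1$. $\min\Gamma(s)$ denotes the unique $\le$-minimal element of $\Gamma(s)$ (it exists since $\Gamma(s)$ is a path in a rooted tree). -}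

module Defs where

open import Data.Nat using (ℕ; _≤_)
open import Data.Fin using (Fin)
open import Data.List using (List; []; _∷_; head; last; length)
open import Data.List.Membership.Propositional using (_∈_)
open import Data.List.Relation.Unary.Linked using (Linked)
open import Data.List.Relation.Unary.AllPairs using (AllPairs)
open import Data.Maybe using (just)
open import Data.Product using (Σ; ∃; _×_)
open import Data.Sum using (_⊎_; inj₁; inj₂)
open import Data.Empty using (⊥)
open import Relation.Nullary using (¬_)
open import Relation.Binary.PropositionalEquality using (_≡_; _≢_)

Adjacency : Set → Set₁
Adjacency A = A → A → Set

IsPath : {A : Set} → Adjacency A → List A → Set
IsPath Adj p = (p ≢ []) × Linked Adj p × AllPairs _≢_ p

PathFromTo : {A : Set} → Adjacency A → A → A → List A → Set
PathFromTo Adj x y p = IsPath Adj p × head p ≡ just x × last p ≡ just y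

IsCycle : {A : Set} → Adjacency A → List A → Set
IsCycle Adj p = (3 ≤ length p) × Linked Adj p × AllPairs _≢_ p
  × Σ _ λ x → Σ _ λ y → head p ≡ just x × last p ≡ just y × Adj y x

Connected : {A : Set} → Adjacency A → Set
Connected Adj = ∀ x y → ∃ λ p → PathFromTo Adj x y p

Acyclic : {A : Set} → Adjacency A → Set
Acyclic Adj = ∀ p → ¬ IsCycle Adj p

IsTree : {A : Set} → Adjacency A → Set
IsTree Adj = (∀ {x y} → Adj x y → Adj y x) × (∀ x → ¬ Adj x x)
  × Connected Adj × Acyclic Adj

IsLeaf : {A : Set} → Adjacency A → A → Set
IsLeaf Adj v = ∀ u w → Adj v u → Adj v w → u ≡ w

IsPathVertexSet : {A : Set} → Adjacency A → (A → Set) → Set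
IsPathVertexSet Adj S = ∃ λ p → IsPath Adj p × (∀ x → (S x → x ∈ p) × (x ∈ p → S x))

TreeLe : {A : Set} → Adjacency A → A → A → A → Set
TreeLe Adj r s₁ s₂ = ∃ λ p → PathFromTo Adj r s₂ p × s₁ ∈ p

BipAdj : {H V : Set} → (H → V → Set) → Adjacency (H ⊎ V)
BipAdj E (inj₁ h) (inj₁ _) = ⊥
BipAdj E (inj₁ h) (inj₂ v) = E h v
BipAdj E (inj₂ v) (inj₁ h) = E h v
BipAdj E (inj₂ v) (inj₂ _) = ⊥

Γ : {H V : Set} → (H → V → Set) → H ⊎ V → (H ⊎ V → Set)
Γ E s t = BipAdj E s t

GLe : {H V : Set} → Adjacency H → Adjacency V → H → V → H ⊎ V → H ⊎ V → Set
GLe TH TV hr vr (inj₁ a) (inj₁ b) = TreeLe TH hr a b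
GLe TH TV hr vr (inj₁ a) (inj₂ b) = ⊥
GLe TH TV hr vr (inj₂ a) (inj₁ b) = ⊥
GLe TH TV hr vr (inj₂ a) (inj₂ b) = TreeLe TV vr a b

Comparable : {A : Set} → (A → A → Set) → A → A → Set
Comparable _≤'_ x y = (x ≤' y) ⊎ (y ≤' x)

IsLeast : {A : Set} → (A → A → Set) → (A → Set) → A → Set
IsLeast _≤'_ S x = S x × (∀ y → S y → x ≤' y)

{-# OPTIONS --safe #-}
module Submission where

-- The vertices of Γ(s₀) ∋ v_root lie on a path of T_V, and a leaf of T_V can only
-- be an endpoint of such a path.  Orienting the path so that it starts at v_root,
-- every vertex s of it is reached from v_root along the initial segment ending at
-- s; of two such initial segments one contains the other, so s₁ and s₂ are comparable.

open import Defs
open import Data.Nat using (ℕ)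
open import Data.Fin using (Fin)
open import Data.Sum using (_⊎_; inj₁; inj₂)
import Data.Sum as Sum
open import Data.Product using (∃; _×_; _,_; proj₁)
open import Data.List using (List; []; _∷_; _++_; [_]; head; last; reverse; _ʳ++_)
open import Data.List.Properties using (reverse-++; reverse-injective)
open import Data.List.Membership.Propositional using (_∈_)
open import Data.List.Membership.Propositional.Properties using (∈-∃++)
open import Data.List.Relation.Unary.Any using (here; there)
open import Data.List.Relation.Unary.All using (_∷_)
import Data.List.Relation.Unary.All.Properties as All
open import Data.List.Relation.Unary.Linked using (Linked; []; [-]; _∷_)
open import Data.List.Relation.Unary.AllPairs using (AllPairs; []; _∷_)
open import Data.List.Relation.Binary.Permutation.Propositional using (↭-sym; ↭⇒↭ₛ)
open import Data.List.Relation.Binary.Permutation.Propositional.Properties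
  using (↭-reverse; ∈-resp-↭)
open import Data.List.Relation.Binary.Permutation.Setoid.Properties using (Unique-resp-↭)
open import Data.Maybe using (just)
open import Relation.Nullary using (¬_)
open import Relation.Binary.Definitions using (Symmetric)
open import Relation.Binary.PropositionalEquality using (_≡_; _≢_; refl; cong; setoid)

module _ {A : Set} where

  Linked-++⁻ˡ : ∀ {R : Adjacency A} xs {ys} → Linked R (xs ++ ys) → Linked R xs
  Linked-++⁻ˡ []           _       = []
  Linked-++⁻ˡ (x ∷ [])     _       = [-]
  Linked-++⁻ˡ (x ∷ y ∷ xs) (r ∷ l) = r ∷ Linked-++⁻ˡ (y ∷ xs) l

  AllPairs-++⁻ˡ : ∀ {S : A → A → Set} xs {ys} → AllPairs S (xs ++ ys) → AllPairs S xs
  AllPairs-++⁻ˡ []       _          = []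
  AllPairs-++⁻ˡ (x ∷ xs) (px ∷ pxs) = All.++⁻ˡ xs px ∷ AllPairs-++⁻ˡ xs pxs

  Linked-reverse : {R : Adjacency A} → Symmetric R → ∀ {xs} → Linked R xs → Linked R (reverse xs)
  Linked-reverse         sym []        = []
  Linked-reverse         sym l@[-]     = l
  Linked-reverse {R = R} sym l@(_ ∷ _) = linked-ʳ++ l [-]
    where
    linked-ʳ++ : ∀ {x xs acc} → Linked R (x ∷ xs) → Linked R (x ∷ acc) → Linked R (xs ʳ++ x ∷ acc)
    linked-ʳ++ [-]     lacc = lacc
    linked-ʳ++ (r ∷ l) lacc = linked-ʳ++ l (sym r ∷ lacc)

  InitialSegmentTo : A → List A → List A → Set
  InitialSegmentTo b xs q = ∃ λ ys → q ≡ xs ++ ys × last xs ≡ just b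

  ∷-InitialSegmentTo : ∀ {x b xs q} → InitialSegmentTo b xs q → InitialSegmentTo b (x ∷ xs) (x ∷ q)
  ∷-InitialSegmentTo {xs = y ∷ _} (ys , refl , lastb) = ys , refl , lastb

  OccursBefore : List A → A → A → Set
  OccursBefore q a b = ∃ λ xs → InitialSegmentTo b xs q × a ∈ xs

  head-OccursBefore : ∀ {x q b} → b ∈ x ∷ q → OccursBefore (x ∷ q) x b
  head-OccursBefore {x} {q} (here refl) = [ x ] , (q , refl , refl) , here refl
  head-OccursBefore {q = _ ∷ _} (there b∈q) with head-OccursBefore b∈q
  ... | xs , seg , _ = _ ∷ xs , ∷-InitialSegmentTo seg , here refl

  ∷-OccursBefore : ∀ {x q a b} → OccursBefore q a b → OccursBefore (x ∷ q) a b
  ∷-OccursBefore (xs , seg , a∈xs) = _ ∷ xs , ∷-InitialSegmentTo seg , there a∈xs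

  OccursBefore-total : ∀ {q a b} → a ∈ q → b ∈ q → OccursBefore q a b ⊎ OccursBefore q b a
  OccursBefore-total (here refl) b∈q         = inj₁ (head-OccursBefore b∈q)
  OccursBefore-total (there a∈q) (here refl) = inj₂ (head-OccursBefore (there a∈q))
  OccursBefore-total (there a∈q) (there b∈q) =
    Sum.map ∷-OccursBefore ∷-OccursBefore (OccursBefore-total a∈q b∈q)

module _ {A : Set} (R : Adjacency A) where

  IsPath-InitialSegmentTo : ∀ {q r b xs} → IsPath R q → head q ≡ just r →
                            InitialSegmentTo b xs q → PathFromTo R r b xs
  IsPath-InitialSegmentTo {xs = x ∷ xs} (_ , lq , uq) refl (ys , refl , lastb) =
    ((λ ()) , Linked-++⁻ˡ (x ∷ xs) lq , AllPairs-++⁻ˡ (x ∷ xs) uq) , refl , lastb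

  IsPath-comparable : ∀ {q r a b} → IsPath R q → head q ≡ just r → a ∈ q → b ∈ q →
                      Comparable (TreeLe R r) a b
  IsPath-comparable path headr a∈q b∈q =
    Sum.map toTreeLe toTreeLe (OccursBefore-total a∈q b∈q)
    where
    toTreeLe : ∀ {a b} → OccursBefore _ a b → TreeLe R _ a b
    toTreeLe (xs , seg , a∈xs) = xs , IsPath-InitialSegmentTo path headr seg , a∈xs

  IsPath-reverse : Symmetric R → ∀ {q} → IsPath R q → IsPath R (reverse q)
  IsPath-reverse sym {q} (q≢[] , lq , uq) =
    (λ rq≡[] → q≢[] (reverse-injective rq≡[])) ,
    Linked-reverse sym lq ,
    Unique-resp-↭ (setoid A) (↭⇒↭ₛ (↭-sym (↭-reverse q))) uq

  interior-¬IsLeaf : Symmetric R → ∀ x xs {r z ys} →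
                     Linked R (x ∷ xs ++ r ∷ z ∷ ys) → AllPairs _≢_ (x ∷ xs ++ r ∷ z ∷ ys) →
                     ¬ IsLeaf R r
  interior-¬IsLeaf sym x []       (xr ∷ rz ∷ _) ((_ ∷ x≢z ∷ _) ∷ _) leaf = x≢z (leaf x _ (sym xr) rz)
  interior-¬IsLeaf sym x (y ∷ xs) (_ ∷ l)       (_ ∷ u)             leaf = interior-¬IsLeaf sym y xs l u leaf

  IsLeaf-endpoint : Symmetric R → ∀ {q r} → IsPath R q → r ∈ q → IsLeaf R r →
                    (∃ λ ys → q ≡ r ∷ ys) ⊎ (∃ λ xs → q ≡ xs ++ [ r ])
  IsLeaf-endpoint sym (_ , lq , uq) r∈q leaf with ∈-∃++ r∈q
  ... | []     , ys    , refl = inj₁ (ys , refl)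
  ... | xs     , []    , refl = inj₂ (xs , refl)
  ... | x ∷ xs , _ ∷ _ , refl with () ← interior-¬IsLeaf sym x xs lq uq leaf

  IsLeaf-comparable : Symmetric R → ∀ {q r a b} → IsPath R q → r ∈ q → IsLeaf R r →
                      a ∈ q → b ∈ q → Comparable (TreeLe R r) a b
  IsLeaf-comparable sym path r∈q leaf a∈q b∈q with IsLeaf-endpoint sym path r∈q leaf
  ... | inj₁ (_ , refl) = IsPath-comparable path refl a∈q b∈q
  ... | inj₂ (xs , refl) =
    IsPath-comparable (IsPath-reverse sym path) (cong head (reverse-++ xs [ _ ]))
      (∈-resp-↭ (↭-sym (↭-reverse _)) a∈q) (∈-resp-↭ (↭-sym (↭-reverse _)) b∈q)

lemma7 : {nH nV : ℕ} (E : Fin nH → Fin nV → Set)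
    (TH : Adjacency (Fin nH)) (TV : Adjacency (Fin nV)) →
    Connected (BipAdj E) → IsTree TH → IsTree TV →
    (∀ h → IsPathVertexSet TV (λ v → E h v)) →
    (∀ v → IsPathVertexSet TH (λ h → E h v)) →
    (hroot : Fin nH) (vroot : Fin nV) → E hroot vroot → IsLeaf TV vroot →
    (s₀ s₁ s₂ : Fin nH ⊎ Fin nV) → Γ E s₀ s₁ → Γ E s₀ s₂ →
    IsLeast (GLe TH TV hroot vroot) (Γ E s₀) (inj₂ vroot) →
    Comparable (GLe TH TV hroot vroot) s₁ s₂
lemma7 E _ TV _ _ (symV , _) pathH _ _ vroot _ leaf (inj₁ h) (inj₂ v₁) (inj₂ v₂) e₁ e₂ (eroot , _)
  with pathH h
... | q , path , vertexSet =
  IsLeaf-comparable TV symV path (∈q eroot) leaf (∈q e₁) (∈q e₂)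
  where
  ∈q : ∀ {v} → E h v → v ∈ q
  ∈q {v} = proj₁ (vertexSet v)
lemma7 _ _ _ _ _ _ _ _ _ _ _ _ (inj₁ _) (inj₁ _) _        () _  _
lemma7 _ _ _ _ _ _ _ _ _ _ _ _ (inj₁ _) (inj₂ _) (inj₁ _) _  () _
lemma7 _ _ _ _ _ _ _ _ _ _ _ _ (inj₂ _) _        _        _  _  (() , _)
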